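{- Let $B$ be a finite abelian group and $\beta\in\mathrm{Aut}(B)$. Let $0\to A\xrightarrow{f}B\xrightarrow{g}C\to 0$ be an exact sequence of abelian groups such that $\beta$ restricts to an automorphism $\alpha$ of $A$, i.e. $\beta\circ f=f\circ\alpha$ for some $\alpha\in\mathrm{Aut}(A)$. Then $\beta$ induces an automorphism $\gamma$ of $C$ with $\gamma\circ g=g\circ\beta$, and if $\#C$ is odd then $(\beta,B)=(\alpha,A)\cdot(\gamma,C)^{\#A}$.
   Context: For a finite abelian group $B$ and $\sigma\in\mathrm{Aut}(B)$, the symbol $(\sigma,B)\in\{\pm1\}$ denotes the sign of $\sigma$ viewed as a permutation of the set $B$. -}

module Defs where

open import Level using (0ℓ)
open import Data.Nat as ℕ using (ℕ; _<ᵇ_)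
open import Data.Fin using (Fin; toℕ)
open import Data.List using (List; map; allFin)
open import Data.Nat.ListAction using (sum)
open import Data.Bool using (if_then_else_; _∧_)
open import Data.Integer as ℤ using (ℤ; -[1+_])
open import Data.Product using (Σ; ∃; _×_)
open import Function.Bundles using (_↔_; Inverse)
open import Relation.Binary.PropositionalEquality using (_≡_)
open import Algebra.Structures using (IsAbelianGroup)

record FinAbGroup : Set₁ where
  field
    Carrier : Set
    _∙_     : Carrier → Carrier → Carrier
    ε       : Carrier
    _⁻¹     : Carrier → Carrier
    isAbelianGroup : IsAbelianGroup _≡_ _∙_ ε _⁻¹
    order   : ℕ
    enum    : Carrier ↔ Fin order

open FinAbGroup public using (Carrier; order)

#_ : FinAbGroup → ℕ
# G = order G

IsHom : (G H : FinAbGroup) → (Carrier G → Carrier H) → Set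
IsHom G H f = ∀ x y → f (x G∙ y) ≡ (f x H∙ f y)
  where
  open FinAbGroup G using () renaming (_∙_ to _G∙_)
  open FinAbGroup H using () renaming (_∙_ to _H∙_)

record Aut (G : FinAbGroup) : Set where
  field
    perm  : Carrier G ↔ Carrier G
    isHom : IsHom G G (Inverse.to perm)

  ⟦_⟧ : Carrier G → Carrier G
  ⟦_⟧ = Inverse.to perm

open Aut public using (⟦_⟧)

inversions : {n : ℕ} → (Fin n → Fin n) → ℕ
inversions {n} π =
  sum (map (λ i → sum (map (λ j →
        if (toℕ i <ᵇ toℕ j) ∧ (toℕ (π j) <ᵇ toℕ (π i)) then 1 else 0)
      (allFin n))) (allFin n))

signFin : {n : ℕ} → (Fin n → Fin n) → ℤ
signFin π = -[1+ 0 ] ℤ.^ inversions π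

-- (σ , G): the sign of σ as a permutation of the underlying set of G,
-- computed through the enumeration of G (independent of the choice).
sgn : (G : FinAbGroup) → Aut G → ℤ
sgn G σ = signFin (λ i → to (Aut.⟦_⟧ σ (from i)))
  where open Inverse (FinAbGroup.enum G)

record ShortExact (A B C : FinAbGroup)
                  (f : Carrier A → Carrier B)
                  (g : Carrier B → Carrier C) : Set where
  field
    f-hom : IsHom A B f
    g-hom : IsHom B C g
    f-inj : ∀ x y → f x ≡ f y → x ≡ y
    g-surj : ∀ c → ∃ λ b → g b ≡ c
    ker⊆im : ∀ b → g b ≡ FinAbGroup.ε C → ∃ λ a → f a ≡ b
    im⊆ker : ∀ a → g (f a) ≡ FinAbGroup.ε C

-- Choose a set-theoretic section s of g. Then (a , c) ↦ f a + s c identifies B with A × C, and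
-- β acts fibrewise: β (f a + s c) = f (α a + t c) + s (γ c) for a cocycle t : C → A. The parity of
-- a permutation is the parity of the number of pairs whose order it reverses with respect to any
-- tournament on the set; for the lexicographic tournament on A × C this number is the sum of the
-- counts in the fibres plus #A² times the count for γ. Hence (β,B) = ∏_c (α,A) χ(t c) · (γ,C)^#A,
-- where χ(x) is the sign of translation by x, a character of A invariant under automorphisms.
-- Summing β (s c) = f (t c) + s (γ c) over c gives β S = f T + S; since #C · S = f u by Lagrange
-- in C, α u = #C · T + u, so χ(T)^#C = χ(α u) χ(u)⁻¹ = 1. For #C odd this gives χ(T) = 1, and the
-- product collapses to (α,A)^#C · (γ,C)^#A = (α,A) · (γ,C)^#A.

module Submission where

open import Level using (Level; 0ℓ)
open import Algebra.Bundles using (CommutativeMonoid; AbelianGroup)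
open import Algebra.Definitions.RawMonoid using (sum) renaming (_×_ to _×ᴹ_)
open import Algebra.Morphism.Structures using (module MonoidMorphisms)
import Algebra.Properties.AbelianGroup as AbelianGroupProperties
import Algebra.Properties.CommutativeMonoid.Mult as CommutativeMonoidMult
import Algebra.Properties.CommutativeMonoid.Sum as CommutativeMonoidSum
import Algebra.Properties.CommutativeSemigroup as CommutativeSemigroupProperties
import Algebra.Properties.Group as GroupProperties
import Algebra.Properties.Semiring.Sum as SemiringSum
open import Data.Bool.Base using (Bool; true; false; not; _∧_; _xor_; if_then_else_)
open import Data.Bool.Properties using (not-involutive; not-distribˡ-xor; not-distribʳ-xor; xor-annihilates-not)
open import Data.Fin.Base using (Fin; zero; suc; toℕ)
import Data.Fin.Properties as Fin
open import Data.Integer.Base using (-1ℤ; -_; _◃_; _*_; _^_)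
open import Data.Integer.Properties using (-1*i≡-i; neg-involutive; ^-distribˡ-+-*; ^-*-assoc)
import Data.List.Base as List
import Data.List.Properties as List
open import Data.Nat.Base as ℕ using (ℕ; zero; suc; _+_; _<ᵇ_; parity)
open import Data.Nat.Divisibility using (_∣_; _∣0; ∣-refl; ∣m∣n⇒∣m+n)
import Data.Nat.ListAction as ListAction
import Data.Nat.Properties as ℕ
open import Data.Parity.Base as ℙ using (Parity; 0ℙ; 1ℙ; toSign)
import Data.Parity.Properties as ℙ
open import Data.Product.Base using (∃; _×_; _,_; proj₁; proj₂; uncurry)
open import Function.Base using (_∘_; id)
open import Function.Bundles using (_↔_; Inverse; Injection; mk↔ₛ′; _⇔_; mk⇔)
open import Function.Construct.Composition using (_↔-∘_)
open import Function.Construct.Identity using (↔-id)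
open import Function.Construct.Symmetry using (↔-sym)
open import Function.Properties.Inverse using (↔⇒↣)
open import Relation.Binary.Definitions using (DecidableEquality)
open import Relation.Binary.PropositionalEquality
open import Relation.Nullary.Decidable using (yes; no; does; via-injection; does-⇔; dec-true; dec-false)
open import Relation.Nullary.Negation using (¬_; contradiction)

open import Defs

open Inverse using (to; from)

-- Agrees definitionally with the indicator used in `inversions`.
𝟙 : Bool → ℕ
𝟙 b = if b then 1 else 0

<ᵇ-irrefl : ∀ m → (m <ᵇ m) ≡ false
<ᵇ-irrefl zero    = refl
<ᵇ-irrefl (suc m) = <ᵇ-irrefl m

<ᵇ-converse : ∀ {m n} → m ≢ n → (n <ᵇ m) ≡ not (m <ᵇ n)
<ᵇ-converse {zero}  {zero}  m≢n = contradiction refl m≢n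
<ᵇ-converse {zero}  {suc n} m≢n = refl
<ᵇ-converse {suc m} {zero}  m≢n = refl
<ᵇ-converse {suc m} {suc n} m≢n = <ᵇ-converse (m≢n ∘ cong suc)

𝟙-∧-split : ∀ l p → 𝟙 p ≡ 𝟙 (l ∧ p) + 𝟙 (not l ∧ p)
𝟙-∧-split false p = refl
𝟙-∧-split true false = refl
𝟙-∧-split true true = refl

parity-𝟙-∧-xor : ∀ l p q → parity (𝟙 (l ∧ (p xor q))) ≡ parity (𝟙 (l ∧ p) + 𝟙 (l ∧ q))
parity-𝟙-∧-xor false p q = refl
parity-𝟙-∧-xor true false q = refl
parity-𝟙-∧-xor true true false = refl
parity-𝟙-∧-xor true true true = refl

xor-telescope : ∀ a b c → a xor c ≡ (a xor b) xor (b xor c)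
xor-telescope false false c = refl
xor-telescope false true  c = sym (not-involutive c)
xor-telescope true  false c = refl
xor-telescope true  true  c = refl

xor-interchange : ∀ a b c d → (a xor b) xor (c xor d) ≡ (a xor c) xor (b xor d)
xor-interchange false false c d = refl
xor-interchange false true  c d = not-distribʳ-xor c d
xor-interchange true  false c d = not-distribˡ-xor c d
xor-interchange true  true  c d = sym (xor-annihilates-not c d)

xor-cancelˡ : ∀ a b → a xor (a xor b) ≡ b
xor-cancelˡ false b = refl
xor-cancelˡ true  b = not-involutive b

∧-not≡∧-xor : ∀ l m → l ∧ not m ≡ l ∧ (l xor m)
∧-not≡∧-xor false m = refl
∧-not≡∧-xor true  m = refl

parity-l*l* : ∀ l k → parity (l ℕ.* (l ℕ.* k)) ≡ parity l ℙ.* parity k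
parity-l*l* l k = begin
  parity (l ℕ.* (l ℕ.* k))                 ≡⟨ trans (ℙ.*-homo-* l _) (cong (parity l ℙ.*_) (ℙ.*-homo-* l k)) ⟩
  parity l ℙ.* (parity l ℙ.* parity k)     ≡⟨ ℙ.*-assoc (parity l) (parity l) (parity k) ⟨
  (parity l ℙ.* parity l) ℙ.* parity k     ≡⟨ cong (ℙ._* parity k) (ℙ.*-idem (parity l)) ⟩
  parity l ℙ.* parity k                    ∎
  where open ≡-Reasoning

×-parity : ∀ n p → _×ᴹ_ ℙ.+-0-rawMonoid n p ≡ parity n ℙ.* p
×-parity zero    p = refl
×-parity (suc n) p = begin
  p ℙ.+ _×ᴹ_ ℙ.+-0-rawMonoid n p     ≡⟨ cong (p ℙ.+_) (×-parity n p) ⟩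
  p ℙ.+ (parity n ℙ.* p)            ≡⟨ ℙ.*-distribʳ-+ p 1ℙ (parity n) ⟨
  (1ℙ ℙ.+ parity n) ℙ.* p           ≡⟨ cong (ℙ._* p) (ℙ.+-homo-+ 1 n) ⟨
  parity (suc n) ℙ.* p              ∎
  where open ≡-Reasoning

odd⇒parity≡1ℙ : ∀ {n} → ¬ 2 ∣ n → parity n ≡ 1ℙ
odd⇒parity≡1ℙ {zero}        ¬2∣n = contradiction (2 ∣0) ¬2∣n
odd⇒parity≡1ℙ {suc zero}    ¬2∣n = refl
odd⇒parity≡1ℙ {suc (suc n)} ¬2∣n = odd⇒parity≡1ℙ (¬2∣n ∘ ∣m∣n⇒∣m+n (∣-refl {2}))

to-injective : ∀ {A B : Set} (e : A ↔ B) {x y} → to e x ≡ to e y → x ≡ y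
to-injective e = Injection.injective (↔⇒↣ e)

sum-allFin : ∀ n (h : Fin n → ℕ) → ListAction.sum (List.map h (List.allFin n)) ≡ sum ℕ.+-0-rawMonoid h
sum-allFin n h = go id
  where
  go : ∀ {m} (g : Fin m → Fin n) → ListAction.sum (List.map h (List.tabulate g)) ≡ sum ℕ.+-0-rawMonoid (h ∘ g)
  go {zero}  g = refl
  go {suc m} g = cong (h (g zero) +_) (go (g ∘ suc))

-- Sums over enumerated sets

module IndexedSum {c ℓ} (M : CommutativeMonoid c ℓ) {X : Set} {n : ℕ} (enum : X ↔ Fin n) where
  private module M = CommutativeMonoid M
  open M using (_≈_; _∙_; rawMonoid)
  open CommutativeMonoidSum M using (sum-cong-≗; ∑-distrib-+; ∑-permute; sum-replicate)

  -- Opaque, so that unification can read the summand off an application of ∑.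
  opaque
    ∑ : (X → M.Carrier) → M.Carrier
    ∑ h = sum rawMonoid (h ∘ from enum)

    ∑-cong : ∀ {h k : X → M.Carrier} → (∀ x → h x ≡ k x) → ∑ h ≡ ∑ k
    ∑-cong h≗k = sum-cong-≗ (h≗k ∘ from enum)

    ∑-distrib : (h k : X → M.Carrier) → ∑ (λ x → h x ∙ k x) ≈ ∑ h ∙ ∑ k
    ∑-distrib h k = ∑-distrib-+ (h ∘ from enum) (k ∘ from enum)

    ∑-replicate : ∀ x → ∑ (λ _ → x) ≈ _×ᴹ_ rawMonoid n x
    ∑-replicate x = sum-replicate n

    ∑-relabel : (π : X ↔ X) (h : X → M.Carrier) → ∑ (h ∘ to π) ≈ ∑ h
    ∑-relabel π h = M.sym (M.trans (∑-permute (h ∘ from enum) (enum ↔-∘ (π ↔-∘ ↔-sym enum)))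
      (M.reflexive (sum-cong-≗ λ i → cong h (Inverse.strictlyInverseʳ enum (to π (from enum i))))))

module _ {a b ℓ₁ ℓ₂ : Level} {M : CommutativeMonoid a ℓ₁} {N : CommutativeMonoid b ℓ₂} where
  private
    module M = CommutativeMonoid M
    module N = CommutativeMonoid N
  open MonoidMorphisms M.rawMonoid N.rawMonoid using (IsMonoidHomomorphism)

  module _ {φ : M.Carrier → N.Carrier} (φ-homo : IsMonoidHomomorphism φ) where
    open IsMonoidHomomorphism φ-homo

    opaque
      unfolding IndexedSum.∑

      ∑-homo : ∀ {X : Set} {n} (enum : X ↔ Fin n) (h : X → M.Carrier) →
               φ (IndexedSum.∑ M enum h) N.≈ IndexedSum.∑ N enum (φ ∘ h)
      ∑-homo enum h = sum-homo (h ∘ from enum)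
        where
        sum-homo : ∀ {n} (v : Fin n → M.Carrier) → φ (sum M.rawMonoid v) N.≈ sum N.rawMonoid (φ ∘ v)
        sum-homo {zero}  v = ε-homo
        sum-homo {suc n} v = N.trans (homo _ _) (N.∙-congˡ (sum-homo (v ∘ suc)))

    ×-homo : ∀ n x → φ (_×ᴹ_ M.rawMonoid n x) N.≈ _×ᴹ_ N.rawMonoid n (φ x)
    ×-homo zero    x = ε-homo
    ×-homo (suc n) x = N.trans (homo _ _) (N.∙-congˡ (×-homo n x))

module ParitySum = IndexedSum ℙ.+-0-commutativeMonoid

module Enumerated {X : Set} {n : ℕ} (enum : X ↔ Fin n) where
  open IndexedSum ℕ.+-0-commutativeMonoid enum public hiding (∑-replicate)
  open CommutativeMonoidSum ℕ.+-0-commutativeMonoid using (sum-cong-≗; sum-replicate-zero)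
  open SemiringSum ℕ.+-*-semiring using (*-distribˡ-sum)

  infix 4 _≟_ _≡ᵇ_

  _≟_ : DecidableEquality X
  _≟_ = via-injection (↔⇒↣ enum) Fin._≟_

  _≡ᵇ_ : X → X → Bool
  x ≡ᵇ y = does (x ≟ y)

  parity-∑ : (h : X → ℕ) → parity (∑ h) ≡ ParitySum.∑ enum (parity ∘ h)
  parity-∑ = ∑-homo ℙ.parity-isMonoidHomomorphism enum

  parity-∑-cong : {h k : X → ℕ} → (∀ x → parity (h x) ≡ parity (k x)) → parity (∑ h) ≡ parity (∑ k)
  parity-∑-cong {h} {k} h≡k = trans (parity-∑ h) (trans (ParitySum.∑-cong enum h≡k) (sym (parity-∑ k)))

  opaque
    unfolding ∑

    ∑-const : ∀ c → ∑ (λ _ → c) ≡ n ℕ.* c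
    ∑-const c = go n
      where
      go : ∀ m → sum ℕ.+-0-rawMonoid {m} (λ _ → c) ≡ m ℕ.* c
      go zero    = refl
      go (suc m) = cong (c +_) (go m)

    ∑-*ˡ : ∀ c (h : X → ℕ) → ∑ (λ x → c ℕ.* h x) ≡ c ℕ.* ∑ h
    ∑-*ˡ c h = sym (*-distribˡ-sum c (h ∘ from enum))

    ∑-δ : ∀ x (h : X → ℕ) → ∑ (λ y → 𝟙 (x ≡ᵇ y) ℕ.* h y) ≡ h x
    ∑-δ x h = begin
      ∑ (λ y → 𝟙 (x ≡ᵇ y) ℕ.* h y)
        ≡⟨ sum-cong-≗ (λ i → cong (λ j → 𝟙 (does (to enum x Fin.≟ j)) ℕ.* h (from enum i))
                                 (Inverse.strictlyInverseˡ enum i)) ⟩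
      sum ℕ.+-0-rawMonoid (λ i → 𝟙 (does (to enum x Fin.≟ i)) ℕ.* h (from enum i))
        ≡⟨ sum-δ (to enum x) (h ∘ from enum) ⟩
      h (from enum (to enum x))
        ≡⟨ cong h (Inverse.strictlyInverseʳ enum x) ⟩
      h x ∎
      where
      open ≡-Reasoning
      sum-δ : ∀ {m} (j : Fin m) (h : Fin m → ℕ) → sum ℕ.+-0-rawMonoid (λ i → 𝟙 (does (j Fin.≟ i)) ℕ.* h i) ≡ h j
      sum-δ {suc m} zero h = trans (cong₂ _+_ (ℕ.*-identityˡ (h zero)) (sum-replicate-zero m)) (ℕ.+-identityʳ (h zero))
      sum-δ (suc j) h = sum-δ j (h ∘ suc)

    ∑-comm : ∀ {Y : Set} {m} (eY : Y ↔ Fin m) (h : X → Y → ℕ) →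
             ∑ (λ x → IndexedSum.∑ ℕ.+-0-commutativeMonoid eY (h x))
               ≡ IndexedSum.∑ ℕ.+-0-commutativeMonoid eY (λ y → ∑ λ x → h x y)
    ∑-comm eY h = CommutativeMonoidSum.∑-comm ℕ.+-0-commutativeMonoid (λ i j → h (from enum i) (from eY j))

-- Parity of permutations via tournaments

record IsTournament {X : Set} (o : X → X → Bool) : Set where
  field
    irreflexive : ∀ x → o x x ≡ false
    converse    : ∀ {x y} → x ≢ y → o y x ≡ not (o x y)

record IsSimpleGraph {X : Set} (R : X → X → Bool) : Set where
  field
    irreflexive : ∀ x → R x x ≡ false
    symmetric   : ∀ x y → R x y ≡ R y x

module PermutationParity {X : Set} {n : ℕ} (enum : X ↔ Fin n) where
  open Enumerated enum

  infix 7 _≺_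

  _≺_ : X → X → Bool
  x ≺ y = toℕ (to enum x) <ᵇ toℕ (to enum y)

  ≺-isTournament : IsTournament _≺_
  ≺-isTournament = record
    { irreflexive = λ x → <ᵇ-irrefl (toℕ (to enum x))
    ; converse    = λ x≢y → <ᵇ-converse (x≢y ∘ to-injective enum ∘ Fin.toℕ-injective)
    }

  pairCount : (X → X → Bool) → ℕ
  pairCount R = ∑ λ x → ∑ λ y → 𝟙 (R x y)

  ascendingPairCount : (X → X → Bool) → ℕ
  ascendingPairCount R = ∑ λ x → ∑ λ y → 𝟙 (x ≺ y ∧ R x y)

  ascendingPairCount-cong : ∀ {R S} → (∀ x y → R x y ≡ S x y) → ascendingPairCount R ≡ ascendingPairCount S
  ascendingPairCount-cong R≡S = ∑-cong λ x → ∑-cong λ y → cong (λ b → 𝟙 (x ≺ y ∧ b)) (R≡S x y)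

  pairCount≡2*ascendingPairCount : ∀ {R} → IsSimpleGraph R → pairCount R ≡ 2 ℕ.* ascendingPairCount R
  pairCount≡2*ascendingPairCount {R} graph = begin
    pairCount R
      ≡⟨ ∑-cong (λ x → ∑-cong (split x)) ⟩
    ∑ (λ x → ∑ λ y → 𝟙 (x ≺ y ∧ R x y) + 𝟙 (y ≺ x ∧ R y x))
      ≡⟨ ∑-cong (λ x → ∑-distrib _ _) ⟩
    ∑ (λ x → ∑ (λ y → 𝟙 (x ≺ y ∧ R x y)) + ∑ (λ y → 𝟙 (y ≺ x ∧ R y x)))
      ≡⟨ ∑-distrib _ _ ⟩
    ascendingPairCount R + ∑ (λ x → ∑ λ y → 𝟙 (y ≺ x ∧ R y x))
      ≡⟨ cong (ascendingPairCount R +_) (∑-comm enum _) ⟩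
    ascendingPairCount R + ascendingPairCount R
      ≡⟨ cong (ascendingPairCount R +_) (ℕ.+-identityʳ _) ⟨
    2 ℕ.* ascendingPairCount R ∎
    where
    open ≡-Reasoning
    open IsSimpleGraph graph
    split : ∀ x y → 𝟙 (R x y) ≡ 𝟙 (x ≺ y ∧ R x y) + 𝟙 (y ≺ x ∧ R y x)
    split x y with x ≟ y
    ... | yes refl rewrite irreflexive x | IsTournament.irreflexive ≺-isTournament x = refl
    ... | no x≢y rewrite IsTournament.converse ≺-isTournament x≢y | symmetric y x = 𝟙-∧-split (x ≺ y) (R x y)

  pairCount-relabel : ∀ R (π : X ↔ X) → pairCount (λ x y → R (to π x) (to π y)) ≡ pairCount R
  pairCount-relabel R π =
    trans (∑-cong λ x → ∑-relabel π (λ y → 𝟙 (R (to π x) y))) (∑-relabel π λ x → ∑ λ y → 𝟙 (R x y))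

  -- Relabelling permutes the ordered pairs, of which there are twice as many as ascending ones.
  ascendingPairCount-relabel : ∀ {R} → IsSimpleGraph R → (π : X ↔ X) →
                               ascendingPairCount (λ x y → R (to π x) (to π y)) ≡ ascendingPairCount R
  ascendingPairCount-relabel {R} graph π = ℕ.*-cancelˡ-≡ _ _ 2 (begin
    2 ℕ.* ascendingPairCount (λ x y → R (to π x) (to π y)) ≡⟨ pairCount≡2*ascendingPairCount relabelled ⟨
    pairCount (λ x y → R (to π x) (to π y))             ≡⟨ pairCount-relabel R π ⟩
    pairCount R                                         ≡⟨ pairCount≡2*ascendingPairCount graph ⟩
    2 ℕ.* ascendingPairCount R                          ∎)
    where
    open ≡-Reasoning
    open IsSimpleGraph graph
    relabelled : IsSimpleGraph (λ x y → R (to π x) (to π y))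
    relabelled = record { irreflexive = irreflexive ∘ to π ; symmetric = λ x y → symmetric (to π x) (to π y) }

  parity-ascendingPairCount-xor : ∀ R S → parity (ascendingPairCount (λ x y → R x y xor S x y))
                                         ≡ parity (ascendingPairCount R) ℙ.+ parity (ascendingPairCount S)
  parity-ascendingPairCount-xor R S = begin
    parity (ascendingPairCount (λ x y → R x y xor S x y))
      ≡⟨ parity-∑-cong (λ x → parity-∑-cong λ y → parity-𝟙-∧-xor (x ≺ y) (R x y) (S x y)) ⟩
    parity (∑ λ x → ∑ λ y → 𝟙 (x ≺ y ∧ R x y) + 𝟙 (x ≺ y ∧ S x y))
      ≡⟨ cong parity (trans (∑-cong λ x → ∑-distrib _ _) (∑-distrib _ _)) ⟩
    parity (ascendingPairCount R + ascendingPairCount S)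
      ≡⟨ ℙ.+-homo-+ (ascendingPairCount R) (ascendingPairCount S) ⟩
    parity (ascendingPairCount R) ℙ.+ parity (ascendingPairCount S) ∎
    where open ≡-Reasoning

  discordant : (X → X → Bool) → X ↔ X → X → X → Bool
  discordant o π x y = o x y xor o (to π x) (to π y)

  discordant-isSimpleGraph : ∀ {o} → IsTournament o → (π : X ↔ X) → IsSimpleGraph (discordant o π)
  discordant-isSimpleGraph {o} tournament π = record { irreflexive = irreflexive′ ; symmetric = symmetric }
    where
    open IsTournament tournament
    irreflexive′ : ∀ x → discordant o π x x ≡ false
    irreflexive′ x rewrite irreflexive x | irreflexive (to π x) = refl
    symmetric : ∀ x y → discordant o π x y ≡ discordant o π y x
    symmetric x y with x ≟ y
    ... | yes refl = refl
    ... | no x≢y rewrite converse x≢y | converse (x≢y ∘ to-injective π) = sym (xor-annihilates-not (o x y) (o (to π x) (to π y)))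

  parityAlong : (X → X → Bool) → X ↔ X → Parity
  parityAlong o π = parity (ascendingPairCount (discordant o π))

  parityAlong-∘ : ∀ {o} → IsTournament o → (π σ : X ↔ X) →
                  parityAlong o (π ↔-∘ σ) ≡ parityAlong o σ ℙ.+ parityAlong o π
  parityAlong-∘ {o} tournament π σ = begin
    parityAlong o (π ↔-∘ σ)
      ≡⟨ cong parity (ascendingPairCount-cong λ x y →
           xor-telescope (o x y) (o (to σ x) (to σ y)) (o (to π (to σ x)) (to π (to σ y)))) ⟩
    parity (ascendingPairCount λ x y → discordant o σ x y xor discordant o π (to σ x) (to σ y))
      ≡⟨ parity-ascendingPairCount-xor _ _ ⟩
    parityAlong o σ ℙ.+ parity (ascendingPairCount λ x y → discordant o π (to σ x) (to σ y))
      ≡⟨ cong (λ k → parityAlong o σ ℙ.+ parity k) (ascendingPairCount-relabel (discordant-isSimpleGraph tournament π) σ) ⟩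
    parityAlong o σ ℙ.+ parityAlong o π ∎
    where open ≡-Reasoning

  parityAlong-simpleGraph : ∀ {R} → IsSimpleGraph R → (π : X ↔ X) → parityAlong R π ≡ 0ℙ
  parityAlong-simpleGraph {R} graph π = begin
    parityAlong R π
      ≡⟨ parity-ascendingPairCount-xor _ _ ⟩
    parity (ascendingPairCount R) ℙ.+ parity (ascendingPairCount λ x y → R (to π x) (to π y))
      ≡⟨ cong (λ k → parity (ascendingPairCount R) ℙ.+ parity k) (ascendingPairCount-relabel graph π) ⟩
    parity (ascendingPairCount R) ℙ.+ parity (ascendingPairCount R)
      ≡⟨ ℙ.p+p≡0ℙ (parity (ascendingPairCount R)) ⟩
    0ℙ ∎
    where open ≡-Reasoning

  -- o′ = o xor D for the simple graph D, and parityAlong vanishes on simple graphs.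
  parityAlong-independent : ∀ {o o′} → IsTournament o → IsTournament o′ → (π : X ↔ X) →
                            parityAlong o′ π ≡ parityAlong o π
  parityAlong-independent {o} {o′} t t′ π = begin
    parityAlong o′ π
      ≡⟨ cong parity (ascendingPairCount-cong λ x y → trans
           (cong₂ _xor_ (sym (xor-cancelˡ (o x y) (o′ x y))) (sym (xor-cancelˡ (o (to π x) (to π y)) (o′ (to π x) (to π y)))))
           (xor-interchange (o x y) (D x y) (o (to π x) (to π y)) (D (to π x) (to π y)))) ⟩
    parity (ascendingPairCount λ x y → discordant o π x y xor discordant D π x y)
      ≡⟨ parity-ascendingPairCount-xor _ _ ⟩
    parityAlong o π ℙ.+ parityAlong D π
      ≡⟨ cong (parityAlong o π ℙ.+_) (parityAlong-simpleGraph D-isSimpleGraph π) ⟩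
    parityAlong o π ℙ.+ 0ℙ
      ≡⟨ ℙ.+-identityʳ _ ⟩
    parityAlong o π ∎
    where
    open ≡-Reasoning
    D : X → X → Bool
    D x y = o x y xor o′ x y
    D-isSimpleGraph : IsSimpleGraph D
    D-isSimpleGraph = record { irreflexive = irreflexive ; symmetric = symmetric }
      where
      irreflexive : ∀ x → D x x ≡ false
      irreflexive x rewrite IsTournament.irreflexive t x | IsTournament.irreflexive t′ x = refl
      symmetric : ∀ x y → D x y ≡ D y x
      symmetric x y with x ≟ y
      ... | yes refl = refl
      ... | no x≢y rewrite IsTournament.converse t x≢y | IsTournament.converse t′ x≢y = sym (xor-annihilates-not (o x y) (o′ x y))

  permParity : X ↔ X → Parity
  permParity = parityAlong _≺_

  permParity-∘ : (π σ : X ↔ X) → permParity (π ↔-∘ σ) ≡ permParity σ ℙ.+ permParity π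
  permParity-∘ = parityAlong-∘ ≺-isTournament

  permParity-cong : {π σ : X ↔ X} → (∀ x → to π x ≡ to σ x) → permParity π ≡ permParity σ
  permParity-cong π≗σ = cong parity (ascendingPairCount-cong λ x y → cong₂ (λ u v → x ≺ y xor u ≺ v) (π≗σ x) (π≗σ y))

  permParity-id : permParity (↔-id X) ≡ 0ℙ
  permParity-id = trans (permParity-∘ (↔-id X) (↔-id X)) (ℙ.p+p≡0ℙ (permParity (↔-id X)))

  permParity-sym : (π : X ↔ X) → permParity (↔-sym π) ≡ permParity π
  permParity-sym π = ℙ.+-cancelʳ-≡ (permParity π) (permParity (↔-sym π)) (permParity π) (begin
    permParity (↔-sym π) ℙ.+ permParity π  ≡⟨ permParity-∘ π (↔-sym π) ⟨
    permParity (π ↔-∘ ↔-sym π)             ≡⟨ permParity-cong {π ↔-∘ ↔-sym π} {↔-id X} (Inverse.strictlyInverseˡ π) ⟩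
    permParity (↔-id X)                    ≡⟨ permParity-id ⟩
    0ℙ                                     ≡⟨ ℙ.p+p≡0ℙ (permParity π) ⟨
    permParity π ℙ.+ permParity π          ∎)
    where open ≡-Reasoning

  permParity-conjugate : (σ π : X ↔ X) → permParity (σ ↔-∘ (π ↔-∘ ↔-sym σ)) ≡ permParity π
  permParity-conjugate σ π = begin
    permParity (σ ↔-∘ (π ↔-∘ ↔-sym σ))
      ≡⟨ permParity-∘ σ (π ↔-∘ ↔-sym σ) ⟩
    permParity (π ↔-∘ ↔-sym σ) ℙ.+ permParity σ
      ≡⟨ cong (ℙ._+ permParity σ) (trans (permParity-∘ π (↔-sym σ)) (cong (ℙ._+ permParity π) (permParity-sym σ))) ⟩
    permParity σ ℙ.+ permParity π ℙ.+ permParity σ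
      ≡⟨ AbelianGroupProperties.xyx⁻¹≈y ℙ.+-0-abelianGroup (permParity σ) (permParity π) ⟩
    permParity π ∎
    where open ≡-Reasoning

  inversion≡discordant : (π : X ↔ X) → ∀ x y → (x ≺ y ∧ to π y ≺ to π x) ≡ (x ≺ y ∧ discordant _≺_ π x y)
  inversion≡discordant π x y with x ≟ y
  ... | yes refl rewrite IsTournament.irreflexive ≺-isTournament x = refl
  ... | no x≢y rewrite IsTournament.converse ≺-isTournament (x≢y ∘ to-injective π) = ∧-not≡∧-xor (x ≺ y) _

  opaque
    unfolding ∑

    inversions≡ascendingPairCount : (π : X ↔ X) →
      inversions (λ i → to enum (to π (from enum i))) ≡ ascendingPairCount (discordant _≺_ π)
    inversions≡ascendingPairCount π = begin
      inversions π̂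
        ≡⟨ trans (cong ListAction.sum (List.map-cong (λ i → sum-allFin n (inverted i)) (List.allFin n)))
                 (sum-allFin n (λ i → sum ℕ.+-0-rawMonoid (inverted i))) ⟩
      sum ℕ.+-0-rawMonoid (λ i → sum ℕ.+-0-rawMonoid (inverted i))
        ≡⟨ sum-cong-≗ (λ i → sum-cong-≗ λ j →
             cong₂ (λ i′ j′ → 𝟙 ((toℕ i′ <ᵇ toℕ j′) ∧ (toℕ (π̂ j) <ᵇ toℕ (π̂ i))))
                   (sym (Inverse.strictlyInverseˡ enum i)) (sym (Inverse.strictlyInverseˡ enum j))) ⟩
      ∑ (λ x → ∑ λ y → 𝟙 (x ≺ y ∧ to π y ≺ to π x))
        ≡⟨ ∑-cong (λ x → ∑-cong λ y → cong 𝟙 (inversion≡discordant π x y)) ⟩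
      ascendingPairCount (discordant _≺_ π) ∎
      where
      open ≡-Reasoning
      open CommutativeMonoidSum ℕ.+-0-commutativeMonoid using (sum-cong-≗)
      π̂ : Fin n → Fin n
      π̂ i = to enum (to π (from enum i))
      inverted : Fin n → Fin n → ℕ
      inverted i j = 𝟙 ((toℕ i <ᵇ toℕ j) ∧ (toℕ (π̂ j) <ᵇ toℕ (π̂ i)))

-- Permutations of a fibred set

module Fibration {X Y Z : Set} {l m n : ℕ} (eX : X ↔ Fin l) (eY : Y ↔ Fin m) (eZ : Z ↔ Fin n)
                 (split : Z ↔ (X × Y)) where
  private
    module X where
      open Enumerated eX public
      open PermutationParity eX public
    module Y where
      open Enumerated eY public
      open PermutationParity eY public
    module Z where
      open Enumerated eZ public
      open PermutationParity eZ public

  join : X → Y → Z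
  join x y = from split (x , y)

  fibre : Z → X
  fibre = proj₁ ∘ to split

  base : Z → Y
  base = proj₂ ∘ to split

  split-join : ∀ x y → to split (join x y) ≡ (x , y)
  split-join x y = Inverse.strictlyInverseˡ split (x , y)

  join-split : ∀ z → join (fibre z) (base z) ≡ z
  join-split = Inverse.strictlyInverseʳ split

  ∑-split : (h : Z → ℕ) → Z.∑ h ≡ Y.∑ λ y → X.∑ λ x → h (join x y)
  ∑-split h = begin
    Z.∑ h
      ≡⟨ Z.∑-cong (λ z → Y.∑-δ (base z) (λ _ → h z)) ⟨
    Z.∑ (λ z → Y.∑ λ y → 𝟙 (base z Y.≡ᵇ y) ℕ.* h z)
      ≡⟨ Z.∑-comm eY (λ z y → 𝟙 (base z Y.≡ᵇ y) ℕ.* h z) ⟩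
    Y.∑ (λ y → Z.∑ λ z → 𝟙 (base z Y.≡ᵇ y) ℕ.* h z)
      ≡⟨ Y.∑-cong (λ y → Z.∑-cong (fibreCount y)) ⟩
    Y.∑ (λ y → Z.∑ λ z → X.∑ λ x → 𝟙 (join x y Z.≡ᵇ z) ℕ.* h z)
      ≡⟨ Y.∑-cong (λ y → Z.∑-comm eX (λ z x → 𝟙 (join x y Z.≡ᵇ z) ℕ.* h z)) ⟩
    Y.∑ (λ y → X.∑ λ x → Z.∑ λ z → 𝟙 (join x y Z.≡ᵇ z) ℕ.* h z)
      ≡⟨ Y.∑-cong (λ y → X.∑-cong λ x → Z.∑-δ (join x y) h) ⟩
    Y.∑ (λ y → X.∑ λ x → h (join x y)) ∎
    where
    open ≡-Reasoning
    fibreCount : ∀ y z → 𝟙 (base z Y.≡ᵇ y) ℕ.* h z ≡ X.∑ λ x → 𝟙 (join x y Z.≡ᵇ z) ℕ.* h z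
    fibreCount y z with base z Y.≟ y
    ... | yes refl rewrite dec-true (base z Y.≟ base z) refl =
      sym (trans (X.∑-cong λ x → cong (λ b → 𝟙 b ℕ.* h z) (does-⇔ join≡⇔ (join x (base z) Z.≟ z) (fibre z X.≟ x)))
                                (trans (X.∑-δ (fibre z) (λ _ → h z)) (sym (ℕ.+-identityʳ (h z)))))
      where
      join≡⇔ : ∀ {x} → (join x (base z) ≡ z) ⇔ (fibre z ≡ x)
      join≡⇔ {x} = mk⇔ (λ e → trans (cong fibre (sym e)) (cong proj₁ (split-join x (base z))))
                       (λ e → trans (cong (λ x′ → join x′ (base z)) (sym e)) (join-split z))
    ... | no base≢y rewrite dec-false (base z Y.≟ y) base≢y =
      sym (trans (X.∑-cong λ x → cong (λ b → 𝟙 b ℕ.* h z) (dec-false (join x y Z.≟ z) (base≢y ∘ base-join x)))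
                                 (trans (X.∑-const 0) (ℕ.*-zeroʳ l)))
      where
      base-join : ∀ x → join x y ≡ z → base z ≡ y
      base-join x e = trans (cong base (sym e)) (cong proj₂ (split-join x y))

  lex : Z → Z → Bool
  lex z z′ = if base z Y.≡ᵇ base z′ then fibre z X.≺ fibre z′ else base z Y.≺ base z′

  lex-isTournament : IsTournament lex
  lex-isTournament = record { irreflexive = irreflexive ; converse = converse }
    where
    irreflexive : ∀ z → lex z z ≡ false
    irreflexive z rewrite dec-true (base z Y.≟ base z) refl = IsTournament.irreflexive X.≺-isTournament (fibre z)
    converse : ∀ {z z′} → z ≢ z′ → lex z′ z ≡ not (lex z z′)
    converse {z} {z′} z≢z′ with base z Y.≟ base z′
    ... | yes e rewrite dec-true (base z Y.≟ base z′) e | dec-true (base z′ Y.≟ base z) (sym e) =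
      IsTournament.converse X.≺-isTournament λ f → z≢z′ (trans (sym (join-split z)) (trans (cong₂ join f e) (join-split z′)))
    ... | no e rewrite dec-false (base z Y.≟ base z′) e | dec-false (base z′ Y.≟ base z) (e ∘ sym) =
      IsTournament.converse Y.≺-isTournament e

  lex-join : ∀ x y x′ y′ → lex (join x y) (join x′ y′) ≡ (if y Y.≡ᵇ y′ then x X.≺ x′ else y Y.≺ y′)
  lex-join x y x′ y′ rewrite split-join x y | split-join x′ y′ = refl

  module _ (τ : Y → X ↔ X) (γ : Y ↔ Y) (π : Z ↔ Z)
           (π-join : ∀ x y → to π (join x y) ≡ join (to (τ y) x) (to γ y)) where

    private
      fibreDiscord : Y → X → X → ℕ
      fibreDiscord y x x′ = 𝟙 (X.discordant X._≺_ (τ y) x x′)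

      baseDiscord : Y → Y → ℕ
      baseDiscord y y′ = 𝟙 (Y.discordant Y._≺_ γ y y′)

      sameBase : Y → Y → ℕ
      sameBase y y′ = 𝟙 (y Y.≡ᵇ y′)

      fibreCount : Y → ℕ
      fibreCount y = X.pairCount (X.discordant X._≺_ (τ y))

      fibreAscending baseAscending : ℕ
      fibreAscending = Y.∑ λ y → X.ascendingPairCount (X.discordant X._≺_ (τ y))
      baseAscending = Y.ascendingPairCount (Y.discordant Y._≺_ γ)

      ∑-l*l* : ∀ {W : Set} {k} (eW : W ↔ Fin k) (h : W → ℕ) →
               Enumerated.∑ eW (λ w → l ℕ.* (l ℕ.* h w)) ≡ l ℕ.* (l ℕ.* Enumerated.∑ eW h)
      ∑-l*l* eW h = trans (Enumerated.∑-*ˡ eW l _) (cong (l ℕ.*_) (Enumerated.∑-*ˡ eW l h))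

    discordant-join : ∀ x y x′ y′ →
      𝟙 (Z.discordant lex π (join x y) (join x′ y′)) ≡ sameBase y y′ ℕ.* fibreDiscord y x x′ + baseDiscord y y′
    discordant-join x y x′ y′
      rewrite π-join x y | π-join x′ y′ | lex-join x y x′ y′ | lex-join (to (τ y) x) (to γ y) (to (τ y′) x′) (to γ y′)
      with y Y.≟ y′
    ... | yes refl rewrite dec-true (y Y.≟ y) refl | dec-true (to γ y Y.≟ to γ y) refl
                         | IsTournament.irreflexive Y.≺-isTournament y | IsTournament.irreflexive Y.≺-isTournament (to γ y) =
      sym (trans (ℕ.+-identityʳ _) (ℕ.*-identityˡ _))
    ... | no y≢y′ rewrite dec-false (y Y.≟ y′) y≢y′ | dec-false (to γ y Y.≟ to γ y′) (y≢y′ ∘ to-injective γ) = refl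

    ∑-fibres-discordant-join : ∀ y y′ → X.∑ (λ x → X.∑ λ x′ → sameBase y y′ ℕ.* fibreDiscord y x x′ + baseDiscord y y′)
                                         ≡ sameBase y y′ ℕ.* fibreCount y + l ℕ.* (l ℕ.* baseDiscord y y′)
    ∑-fibres-discordant-join y y′ = begin
      X.∑ (λ x → X.∑ λ x′ → sameBase y y′ ℕ.* fibreDiscord y x x′ + baseDiscord y y′)
        ≡⟨ X.∑-cong (λ x → X.∑-distrib _ _) ⟩
      X.∑ (λ x → X.∑ (λ x′ → sameBase y y′ ℕ.* fibreDiscord y x x′) + X.∑ (λ _ → baseDiscord y y′))
        ≡⟨ X.∑-cong (λ x → cong₂ _+_ (X.∑-*ˡ (sameBase y y′) (fibreDiscord y x)) (X.∑-const (baseDiscord y y′))) ⟩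
      X.∑ (λ x → sameBase y y′ ℕ.* X.∑ (fibreDiscord y x) + l ℕ.* baseDiscord y y′)
        ≡⟨ X.∑-distrib _ _ ⟩
      X.∑ (λ x → sameBase y y′ ℕ.* X.∑ (fibreDiscord y x)) + X.∑ (λ _ → l ℕ.* baseDiscord y y′)
        ≡⟨ cong₂ _+_ (X.∑-*ˡ (sameBase y y′) (λ x → X.∑ (fibreDiscord y x))) (X.∑-const (l ℕ.* baseDiscord y y′)) ⟩
      sameBase y y′ ℕ.* fibreCount y + l ℕ.* (l ℕ.* baseDiscord y y′) ∎
      where open ≡-Reasoning

    -- Discordant pairs inside a fibre are those of τ y; a pair from distinct fibres y ≠ y′ is
    -- discordant exactly when (y , y′) is discordant for γ, whichever of the l² fibre points are chosen.
    pairCount-fibred : Z.pairCount (Z.discordant lex π)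
      ≡ Y.∑ fibreCount + l ℕ.* (l ℕ.* Y.pairCount (Y.discordant Y._≺_ γ))
    pairCount-fibred = begin
      Z.pairCount (Z.discordant lex π)
        ≡⟨ ∑-split _ ⟩
      Y.∑ (λ y → X.∑ λ x → Z.∑ λ z′ → 𝟙 (Z.discordant lex π (join x y) z′))
        ≡⟨ Y.∑-cong (λ y → X.∑-cong λ x → ∑-split _) ⟩
      Y.∑ (λ y → X.∑ λ x → Y.∑ λ y′ → X.∑ λ x′ → 𝟙 (Z.discordant lex π (join x y) (join x′ y′)))
        ≡⟨ Y.∑-cong (λ y → X.∑-cong λ x → Y.∑-cong λ y′ → X.∑-cong λ x′ → discordant-join x y x′ y′) ⟩
      Y.∑ (λ y → X.∑ λ x → Y.∑ λ y′ → X.∑ λ x′ → sameBase y y′ ℕ.* fibreDiscord y x x′ + baseDiscord y y′)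
        ≡⟨ Y.∑-cong (λ y → X.∑-comm eY _) ⟩
      Y.∑ (λ y → Y.∑ λ y′ → X.∑ λ x → X.∑ λ x′ → sameBase y y′ ℕ.* fibreDiscord y x x′ + baseDiscord y y′)
        ≡⟨ Y.∑-cong (λ y → Y.∑-cong (∑-fibres-discordant-join y)) ⟩
      Y.∑ (λ y → Y.∑ λ y′ → sameBase y y′ ℕ.* fibreCount y + l ℕ.* (l ℕ.* baseDiscord y y′))
        ≡⟨ Y.∑-cong (λ y → trans (Y.∑-distrib _ _) (cong₂ _+_ (Y.∑-δ y (λ _ → fibreCount y)) (∑-l*l* eY (baseDiscord y)))) ⟩
      Y.∑ (λ y → fibreCount y + l ℕ.* (l ℕ.* Y.∑ (baseDiscord y)))
        ≡⟨ trans (Y.∑-distrib _ _) (cong (Y.∑ fibreCount +_) (∑-l*l* eY (λ y → Y.∑ (baseDiscord y)))) ⟩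
      Y.∑ fibreCount + l ℕ.* (l ℕ.* Y.pairCount (Y.discordant Y._≺_ γ)) ∎
      where open ≡-Reasoning

    ascendingPairCount-fibred : Z.ascendingPairCount (Z.discordant lex π) ≡ fibreAscending + l ℕ.* (l ℕ.* baseAscending)
    ascendingPairCount-fibred = ℕ.*-cancelˡ-≡ _ _ 2 (begin
      2 ℕ.* Z.ascendingPairCount (Z.discordant lex π)
        ≡⟨ Z.pairCount≡2*ascendingPairCount (Z.discordant-isSimpleGraph lex-isTournament π) ⟨
      Z.pairCount (Z.discordant lex π)
        ≡⟨ pairCount-fibred ⟩
      Y.∑ fibreCount + l ℕ.* (l ℕ.* Y.pairCount (Y.discordant Y._≺_ γ))
        ≡⟨ cong₂ (λ u v → u + l ℕ.* (l ℕ.* v))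
             (trans (Y.∑-cong λ y → X.pairCount≡2*ascendingPairCount (X.discordant-isSimpleGraph X.≺-isTournament (τ y))) (Y.∑-*ˡ 2 _))
             (Y.pairCount≡2*ascendingPairCount (Y.discordant-isSimpleGraph Y.≺-isTournament γ)) ⟩
      2 ℕ.* fibreAscending + l ℕ.* (l ℕ.* (2 ℕ.* baseAscending))
        ≡⟨ cong (2 ℕ.* fibreAscending +_) (trans (cong (l ℕ.*_) (x∙yz≈y∙xz l 2 _)) (x∙yz≈y∙xz l 2 _)) ⟩
      2 ℕ.* fibreAscending + 2 ℕ.* (l ℕ.* (l ℕ.* baseAscending))
        ≡⟨ ℕ.*-distribˡ-+ 2 fibreAscending (l ℕ.* (l ℕ.* baseAscending)) ⟨
      2 ℕ.* (fibreAscending + l ℕ.* (l ℕ.* baseAscending)) ∎)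
      where
      open ≡-Reasoning
      open CommutativeSemigroupProperties ℕ.*-commutativeSemigroup using (x∙yz≈y∙xz)

    permParity-fibred : Z.permParity π ≡ ParitySum.∑ eY (λ y → X.permParity (τ y)) ℙ.+ (parity l ℙ.* Y.permParity γ)
    permParity-fibred = begin
      Z.permParity π
        ≡⟨ Z.parityAlong-independent lex-isTournament Z.≺-isTournament π ⟩
      Z.parityAlong lex π
        ≡⟨ cong parity ascendingPairCount-fibred ⟩
      parity (fibreAscending + l ℕ.* (l ℕ.* baseAscending))
        ≡⟨ ℙ.+-homo-+ fibreAscending (l ℕ.* (l ℕ.* baseAscending)) ⟩
      parity fibreAscending ℙ.+ parity (l ℕ.* (l ℕ.* baseAscending))
        ≡⟨ cong₂ ℙ._+_ (Y.parity-∑ _) (parity-l*l* l baseAscending) ⟩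
      ParitySum.∑ eY (λ y → X.permParity (τ y)) ℙ.+ (parity l ℙ.* Y.permParity γ) ∎
      where open ≡-Reasoning

-- Finite abelian groups and short exact sequences

abelianGroup : FinAbGroup → AbelianGroup 0ℓ 0ℓ
abelianGroup G = record { isAbelianGroup = FinAbGroup.isAbelianGroup G }

module FinAbGroupTheory (G : FinAbGroup) where
  open FinAbGroup G public using (enum)
  open AbelianGroup (abelianGroup G) public
    using (_∙_; ε; _⁻¹; assoc; identityˡ; identityʳ; inverseʳ; rawMonoid; commutativeMonoid)
  open GroupProperties (AbelianGroup.group (abelianGroup G)) public
    using (//-rightDividesˡ; //-rightDividesʳ; ∙-cancelʳ; identityˡ-unique; identityʳ-unique; inverseʳ-unique)
  open CommutativeMonoidMult commutativeMonoid public using (×-distrib-+)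
  open Enumerated (FinAbGroup.enum G) public
  open PermutationParity (FinAbGroup.enum G) public
  open MonoidMorphisms rawMonoid ℙ.+-0-rawMonoid using (IsMonoidHomomorphism)

  infixr 8 _·_
  _·_ : ℕ → Carrier G → Carrier G
  _·_ = _×ᴹ_ rawMonoid

  translation : Carrier G → Carrier G ↔ Carrier G
  translation x = mk↔ₛ′ (_∙ x) (_∙ x ⁻¹) (//-rightDividesˡ x) (//-rightDividesʳ x)

  translationParity : Carrier G → Parity
  translationParity x = permParity (translation x)

  translationParity-isMonoidHomomorphism : IsMonoidHomomorphism translationParity
  translationParity-isMonoidHomomorphism = record
    { isMagmaHomomorphism = record
      { isRelHomomorphism = record { cong = cong translationParity }
      ; homo = λ x y → trans (permParity-cong {translation (x ∙ y)} {translation y ↔-∘ translation x} (λ a → sym (assoc a x y)))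
                             (permParity-∘ (translation y) (translation x))
      }
    ; ε-homo = trans (permParity-cong {translation ε} {↔-id _} identityʳ) permParity-id
    }

  translationParity-aut : (σ : Aut G) → ∀ x → translationParity (⟦ σ ⟧ x) ≡ translationParity x
  translationParity-aut σ x = trans
    (permParity-cong {translation (⟦ σ ⟧ x)} {Aut.perm σ ↔-∘ (translation x ↔-∘ ↔-sym (Aut.perm σ))} λ a →
      sym (trans (Aut.isHom σ _ x) (cong (_∙ ⟦ σ ⟧ x) (Inverse.strictlyInverseˡ (Aut.perm σ) a))))
    (permParity-conjugate (Aut.perm σ) (translation x))

  order·≡ε : ∀ x → order G · x ≡ ε
  order·≡ε x = identityʳ-unique (G.∑ id) (order G · x) (begin
    G.∑ id ∙ order G · x          ≡⟨ cong (G.∑ id ∙_) (G.∑-replicate x) ⟨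
    G.∑ id ∙ G.∑ (λ _ → x)        ≡⟨ G.∑-distrib id (λ _ → x) ⟨
    G.∑ (λ y → y ∙ x)             ≡⟨ G.∑-relabel (translation x) id ⟩
    G.∑ id                        ∎)
    where
    open ≡-Reasoning
    module G = IndexedSum commutativeMonoid enum

  inversionCount : Aut G → ℕ
  inversionCount σ = inversions (λ i → to enum (⟦ σ ⟧ (from enum i)))

  parity-inversionCount : (σ : Aut G) → parity (inversionCount σ) ≡ permParity (Aut.perm σ)
  parity-inversionCount σ = cong parity (inversions≡ascendingPairCount (Aut.perm σ))

  Aut-sym : Aut G → Aut G
  Aut-sym σ = record { perm = ↔-sym (Aut.perm σ) ; isHom = isHom }
    where
    open Inverse (Aut.perm σ) using (strictlyInverseˡ)
    isHom : IsHom G G (from (Aut.perm σ))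
    isHom x y = to-injective (Aut.perm σ) (trans (strictlyInverseˡ (x ∙ y))
      (sym (trans (Aut.isHom σ _ _) (cong₂ _∙_ (strictlyInverseˡ x) (strictlyInverseˡ y)))))

module IsHomProperties (G H : FinAbGroup) {φ : Carrier G → Carrier H} (φ-hom : IsHom G H φ) where
  private
    module G = FinAbGroupTheory G
    module H = FinAbGroupTheory H
  open MonoidMorphisms G.rawMonoid H.rawMonoid using (IsMonoidHomomorphism)

  homo-ε : φ G.ε ≡ H.ε
  homo-ε = H.identityˡ-unique (φ G.ε) (φ G.ε) (trans (sym (φ-hom G.ε G.ε)) (cong φ (G.identityˡ G.ε)))

  homo-⁻¹ : ∀ x → φ (x G.⁻¹) ≡ φ x H.⁻¹
  homo-⁻¹ x = H.inverseʳ-unique (φ x) (φ (x G.⁻¹)) (trans (sym (φ-hom x (x G.⁻¹))) (trans (cong φ (G.inverseʳ x)) homo-ε))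

  isMonoidHomomorphism : IsMonoidHomomorphism φ
  isMonoidHomomorphism = record
    { isMagmaHomomorphism = record { isRelHomomorphism = record { cong = cong φ } ; homo = φ-hom }
    ; ε-homo = homo-ε
    }

  homo-· : ∀ n x → φ (n G.· x) ≡ n H.· φ x
  homo-· = ×-homo {M = G.commutativeMonoid} {N = H.commutativeMonoid} isMonoidHomomorphism

  homo-∑ : ∀ {X : Set} {n} (enum : X ↔ Fin n) (h : X → Carrier G) →
           φ (IndexedSum.∑ G.commutativeMonoid enum h) ≡ IndexedSum.∑ H.commutativeMonoid enum (φ ∘ h)
  homo-∑ = ∑-homo isMonoidHomomorphism

module ShortExactSequence {A B C : FinAbGroup} {f : Carrier A → Carrier B} {g : Carrier B → Carrier C}
                          (ses : ShortExact A B C f g) where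
  private
    module A = FinAbGroupTheory A
    module B = FinAbGroupTheory B
    module C = FinAbGroupTheory C
    module f = IsHomProperties A B (ShortExact.f-hom ses)
    module g = IsHomProperties B C (ShortExact.g-hom ses)
  open ShortExact ses

  section : Carrier C → Carrier B
  section c = proj₁ (g-surj c)

  g-section : ∀ c → g (section c) ≡ c
  g-section c = proj₂ (g-surj c)

  g-f∙ : ∀ a b → g (f a B.∙ b) ≡ g b
  g-f∙ a b = trans (g-hom (f a) b) (trans (cong (C._∙ g b) (im⊆ker a)) (C.identityˡ (g b)))

  g-fibre : ∀ {x y} → g x ≡ g y → ∃ λ a → x ≡ f a B.∙ y
  g-fibre {x} {y} gx≡gy = a , sym (begin
    f a B.∙ y              ≡⟨ cong (B._∙ y) fa≡x/y ⟩
    (x B.∙ y B.⁻¹) B.∙ y   ≡⟨ B.//-rightDividesˡ y x ⟩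
    x                      ∎)
    where
    open ≡-Reasoning
    g[x/y]≡ε : g (x B.∙ y B.⁻¹) ≡ C.ε
    g[x/y]≡ε = trans (g-hom x (y B.⁻¹)) (trans (cong₂ C._∙_ gx≡gy (g.homo-⁻¹ y)) (C.inverseʳ (g y)))
    a = proj₁ (ker⊆im _ g[x/y]≡ε)
    fa≡x/y = proj₂ (ker⊆im _ g[x/y]≡ε)

  join : Carrier A → Carrier C → Carrier B
  join a c = f a B.∙ section c

  coordinate : Carrier B → Carrier A
  coordinate b = proj₁ (g-fibre {b} {section (g b)} (sym (g-section (g b))))

  join-coordinate : ∀ b → join (coordinate b) (g b) ≡ b
  join-coordinate b = sym (proj₂ (g-fibre {b} {section (g b)} (sym (g-section (g b)))))

  g-join : ∀ a c → g (join a c) ≡ c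
  g-join a c = trans (g-f∙ a (section c)) (g-section c)

  coordinate-join : ∀ a c → coordinate (join a c) ≡ a
  coordinate-join a c = f-inj _ _ (B.∙-cancelʳ (section c) _ _
    (trans (cong (join (coordinate (join a c))) (sym (g-join a c))) (join-coordinate (join a c))))

  splitting : Carrier B ↔ (Carrier A × Carrier C)
  splitting = mk↔ₛ′ (λ b → coordinate b , g b) (uncurry join)
    (λ (a , c) → cong₂ _,_ (coordinate-join a c) (g-join a c)) join-coordinate

  g-respects : ∀ {φ : Carrier B → Carrier B} {ψ : Carrier A → Carrier A} → IsHom B B φ →
               (∀ a → φ (f a) ≡ f (ψ a)) → ∀ {x y} → g x ≡ g y → g (φ x) ≡ g (φ y)
  g-respects {φ} {ψ} φ-hom φ∘f {x} {y} gx≡gy with g-fibre gx≡gy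
  ... | a , x≡fa∙y = begin
    g (φ x)             ≡⟨ cong (g ∘ φ) x≡fa∙y ⟩
    g (φ (f a B.∙ y))   ≡⟨ cong g (trans (φ-hom (f a) y) (cong (B._∙ φ y) (φ∘f a))) ⟩
    g (f (ψ a) B.∙ φ y) ≡⟨ g-f∙ (ψ a) (φ y) ⟩
    g (φ y)             ∎
    where open ≡-Reasoning

  module Induced (β : Aut B) (α : Aut A) (β∘f : ∀ a → ⟦ β ⟧ (f a) ≡ f (⟦ α ⟧ a)) where

    β⁻¹∘f : ∀ a → ⟦ B.Aut-sym β ⟧ (f a) ≡ f (⟦ A.Aut-sym α ⟧ a)
    β⁻¹∘f a = to-injective (Aut.perm β) (trans (Inverse.strictlyInverseˡ (Aut.perm β) (f a))
      (sym (trans (β∘f _) (cong f (Inverse.strictlyInverseˡ (Aut.perm α) a)))))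

    induced : Aut B → Carrier C → Carrier C
    induced σ c = g (⟦ σ ⟧ (section c))

    inducedAut : Aut C
    inducedAut = record { perm = mk↔ₛ′ (induced β) (induced (B.Aut-sym β)) inverseˡ inverseʳ ; isHom = isHom }
      where
      inverseˡ : ∀ c → induced β (induced (B.Aut-sym β) c) ≡ c
      inverseˡ c = trans (g-respects (Aut.isHom β) β∘f (g-section _))
        (trans (cong g (Inverse.strictlyInverseˡ (Aut.perm β) (section c))) (g-section c))
      inverseʳ : ∀ c → induced (B.Aut-sym β) (induced β c) ≡ c
      inverseʳ c = trans (g-respects (Aut.isHom (B.Aut-sym β)) β⁻¹∘f (g-section _))
        (trans (cong g (Inverse.strictlyInverseʳ (Aut.perm β) (section c))) (g-section c))
      isHom : IsHom C C (induced β)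
      isHom c c′ = begin
        g (⟦ β ⟧ (section (c C.∙ c′)))
          ≡⟨ g-respects (Aut.isHom β) β∘f (trans (g-section _) (sym (trans (g-hom _ _) (cong₂ C._∙_ (g-section c) (g-section c′))))) ⟩
        g (⟦ β ⟧ (section c B.∙ section c′))
          ≡⟨ cong g (Aut.isHom β _ _) ⟩
        g (⟦ β ⟧ (section c) B.∙ ⟦ β ⟧ (section c′))
          ≡⟨ g-hom _ _ ⟩
        induced β c C.∙ induced β c′ ∎
        where open ≡-Reasoning

    inducedAut-g : ∀ b → ⟦ inducedAut ⟧ (g b) ≡ g (⟦ β ⟧ b)
    inducedAut-g b = g-respects (Aut.isHom β) β∘f (g-section (g b))

  module Fibred (β : Aut B) (α : Aut A) (β∘f : ∀ a → ⟦ β ⟧ (f a) ≡ f (⟦ α ⟧ a))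
                (γ : Aut C) (γ∘g : ∀ b → ⟦ γ ⟧ (g b) ≡ g (⟦ β ⟧ b)) where

    private
      g-β-section : ∀ c → g (⟦ β ⟧ (section c)) ≡ g (section (⟦ γ ⟧ c))
      g-β-section c = trans (sym (γ∘g (section c))) (trans (cong ⟦ γ ⟧ (g-section c)) (sym (g-section (⟦ γ ⟧ c))))

    cocycle : Carrier C → Carrier A
    cocycle c = proj₁ (g-fibre (g-β-section c))

    β-section : ∀ c → ⟦ β ⟧ (section c) ≡ f (cocycle c) B.∙ section (⟦ γ ⟧ c)
    β-section c = proj₂ (g-fibre (g-β-section c))

    β-join : ∀ a c → ⟦ β ⟧ (join a c) ≡ join (⟦ α ⟧ a A.∙ cocycle c) (⟦ γ ⟧ c)
    β-join a c = begin
      ⟦ β ⟧ (f a B.∙ section c)                                 ≡⟨ Aut.isHom β (f a) (section c) ⟩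
      ⟦ β ⟧ (f a) B.∙ ⟦ β ⟧ (section c)                         ≡⟨ cong₂ B._∙_ (β∘f a) (β-section c) ⟩
      f (⟦ α ⟧ a) B.∙ (f (cocycle c) B.∙ section (⟦ γ ⟧ c))     ≡⟨ B.assoc _ _ _ ⟨
      (f (⟦ α ⟧ a) B.∙ f (cocycle c)) B.∙ section (⟦ γ ⟧ c)     ≡⟨ cong (B._∙ section (⟦ γ ⟧ c)) (f-hom _ _) ⟨
      join (⟦ α ⟧ a A.∙ cocycle c) (⟦ γ ⟧ c)                    ∎
      where open ≡-Reasoning

    fibrePermutation : Carrier C → Carrier A ↔ Carrier A
    fibrePermutation c = A.translation (cocycle c) ↔-∘ Aut.perm α

    permParity-β-fibred : B.permParity (Aut.perm β)
                   ≡ ParitySum.∑ C.enum (A.permParity ∘ fibrePermutation) ℙ.+ (parity (# A) ℙ.* C.permParity (Aut.perm γ))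
    permParity-β-fibred = Fibration.permParity-fibred A.enum C.enum B.enum splitting
                     fibrePermutation (Aut.perm γ) (Aut.perm β) β-join

    private
      module A∑ = IndexedSum A.commutativeMonoid C.enum
      module B∑ = IndexedSum B.commutativeMonoid C.enum
      module β = IsHomProperties B B (Aut.isHom β)

    cocycleSum : Carrier A
    cocycleSum = A∑.∑ cocycle

    sectionSum : Carrier B
    sectionSum = B∑.∑ section

    β-sectionSum : ⟦ β ⟧ sectionSum ≡ f cocycleSum B.∙ sectionSum
    β-sectionSum = begin
      ⟦ β ⟧ (B∑.∑ section)                                   ≡⟨ β.homo-∑ C.enum section ⟩
      B∑.∑ (⟦ β ⟧ ∘ section)                                 ≡⟨ B∑.∑-cong β-section ⟩
      B∑.∑ (λ c → f (cocycle c) B.∙ section (⟦ γ ⟧ c))       ≡⟨ B∑.∑-distrib (f ∘ cocycle) (section ∘ ⟦ γ ⟧) ⟩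
      B∑.∑ (f ∘ cocycle) B.∙ B∑.∑ (section ∘ ⟦ γ ⟧)          ≡⟨ cong₂ B._∙_ (f.homo-∑ C.enum cocycle)
                                                                            (sym (B∑.∑-relabel (Aut.perm γ) section)) ⟨
      f (A∑.∑ cocycle) B.∙ B∑.∑ section                      ∎
      where open ≡-Reasoning

    order·sectionSum∈image : ∃ λ u → f u ≡ # C B.· sectionSum
    order·sectionSum∈image = ker⊆im _ (trans (g.homo-· (# C) sectionSum) (C.order·≡ε (g sectionSum)))

    α-shifts-by-order·cocycleSum : ∃ λ u → ⟦ α ⟧ u ≡ # C A.· cocycleSum A.∙ u
    α-shifts-by-order·cocycleSum = u , f-inj _ _ (begin
      f (⟦ α ⟧ u)                                     ≡⟨ β∘f u ⟨
      ⟦ β ⟧ (f u)                                     ≡⟨ cong ⟦ β ⟧ fu≡ ⟩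
      ⟦ β ⟧ (# C B.· sectionSum)                      ≡⟨ β.homo-· (# C) sectionSum ⟩
      # C B.· ⟦ β ⟧ sectionSum                        ≡⟨ cong (# C B.·_) β-sectionSum ⟩
      # C B.· (f cocycleSum B.∙ sectionSum)           ≡⟨ B.×-distrib-+ (f cocycleSum) sectionSum (# C) ⟩
      # C B.· f cocycleSum B.∙ # C B.· sectionSum     ≡⟨ cong₂ B._∙_ (f.homo-· (# C) cocycleSum) fu≡ ⟨
      f (# C A.· cocycleSum) B.∙ f u                  ≡⟨ f-hom _ _ ⟨
      f (# C A.· cocycleSum A.∙ u)                    ∎)
      where
      open ≡-Reasoning
      u = proj₁ order·sectionSum∈image
      fu≡ = proj₂ order·sectionSum∈image

    module _ (#C-odd : ¬ 2 ∣ # C) where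
      private
        module χ = MonoidMorphisms.IsMonoidHomomorphism A.translationParity-isMonoidHomomorphism
        χ-· : ∀ n x → A.translationParity (n A.· x) ≡ parity n ℙ.* A.translationParity x
        χ-· n x = trans (×-homo {M = A.commutativeMonoid} {N = ℙ.+-0-commutativeMonoid} A.translationParity-isMonoidHomomorphism n x)
                        (×-parity n (A.translationParity x))

      translationParity-cocycleSum : A.translationParity cocycleSum ≡ 0ℙ
      translationParity-cocycleSum = ℙ.+-cancelʳ-≡ (A.translationParity u) _ _ (begin
        A.translationParity cocycleSum ℙ.+ A.translationParity u
          ≡⟨ cong (λ p → p ℙ.* A.translationParity cocycleSum ℙ.+ A.translationParity u) (odd⇒parity≡1ℙ #C-odd) ⟨
        parity (# C) ℙ.* A.translationParity cocycleSum ℙ.+ A.translationParity u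
          ≡⟨ cong (ℙ._+ A.translationParity u) (χ-· (# C) cocycleSum) ⟨
        A.translationParity (# C A.· cocycleSum) ℙ.+ A.translationParity u
          ≡⟨ χ.homo (# C A.· cocycleSum) u ⟨
        A.translationParity (# C A.· cocycleSum A.∙ u)
          ≡⟨ cong A.translationParity αu≡ ⟨
        A.translationParity (⟦ α ⟧ u)
          ≡⟨ A.translationParity-aut α u ⟩
        A.translationParity u ∎)
        where
        open ≡-Reasoning
        u = proj₁ α-shifts-by-order·cocycleSum
        αu≡ = proj₂ α-shifts-by-order·cocycleSum

      ∑-permParity-fibrePermutation : ParitySum.∑ C.enum (A.permParity ∘ fibrePermutation) ≡ A.permParity (Aut.perm α)
      ∑-permParity-fibrePermutation = begin
        ParitySum.∑ C.enum (A.permParity ∘ fibrePermutation)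
          ≡⟨ ParitySum.∑-cong C.enum (λ c → A.permParity-∘ (A.translation (cocycle c)) (Aut.perm α)) ⟩
        ParitySum.∑ C.enum (λ c → A.permParity (Aut.perm α) ℙ.+ A.translationParity (cocycle c))
          ≡⟨ ParitySum.∑-distrib C.enum (λ _ → A.permParity (Aut.perm α)) (A.translationParity ∘ cocycle) ⟩
        ParitySum.∑ C.enum (λ _ → A.permParity (Aut.perm α)) ℙ.+ ParitySum.∑ C.enum (A.translationParity ∘ cocycle)
          ≡⟨ cong₂ ℙ._+_ (trans (ParitySum.∑-replicate C.enum _) (×-parity (# C) _))
                         (sym (∑-homo A.translationParity-isMonoidHomomorphism C.enum cocycle)) ⟩
        parity (# C) ℙ.* A.permParity (Aut.perm α) ℙ.+ A.translationParity cocycleSum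
          ≡⟨ cong₂ (λ p q → p ℙ.* A.permParity (Aut.perm α) ℙ.+ q) (odd⇒parity≡1ℙ #C-odd) translationParity-cocycleSum ⟩
        A.permParity (Aut.perm α) ℙ.+ 0ℙ
          ≡⟨ ℙ.+-identityʳ _ ⟩
        A.permParity (Aut.perm α) ∎
        where open ≡-Reasoning

      permParity-β : B.permParity (Aut.perm β) ≡ A.permParity (Aut.perm α) ℙ.+ (parity (# A) ℙ.* C.permParity (Aut.perm γ))
      permParity-β = trans permParity-β-fibred
        (cong (ℙ._+ (parity (# A) ℙ.* C.permParity (Aut.perm γ))) ∑-permParity-fibrePermutation)

-1^≡toSign-parity : ∀ n → -1ℤ ^ n ≡ toSign (parity n) ◃ 1
-1^≡toSign-parity zero          = refl
-1^≡toSign-parity (suc zero)    = refl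
-1^≡toSign-parity (suc (suc n)) = begin
  -1ℤ * (-1ℤ * -1ℤ ^ n) ≡⟨ -1*i≡-i _ ⟩
  - (-1ℤ * -1ℤ ^ n)     ≡⟨ cong -_ (-1*i≡-i _) ⟩
  - - (-1ℤ ^ n)         ≡⟨ neg-involutive _ ⟩
  -1ℤ ^ n               ≡⟨ -1^≡toSign-parity n ⟩
  toSign (parity n) ◃ 1 ∎
  where open ≡-Reasoning

-1^-cong-parity : ∀ m n → parity m ≡ parity n → -1ℤ ^ m ≡ -1ℤ ^ n
-1^-cong-parity m n eq = trans (-1^≡toSign-parity m) (trans (cong (λ p → toSign p ◃ 1) eq) (sym (-1^≡toSign-parity n)))


sgn-from-permParity : ∀ {A B C : FinAbGroup} (α : Aut A) (β : Aut B) (γ : Aut C) →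
  FinAbGroupTheory.permParity B (Aut.perm β)
    ≡ FinAbGroupTheory.permParity A (Aut.perm α) ℙ.+ (parity (# A) ℙ.* FinAbGroupTheory.permParity C (Aut.perm γ)) →
  sgn B β ≡ sgn A α * (sgn C γ ^ # A)
sgn-from-permParity {A} {B} {C} α β γ parities = begin
  -1ℤ ^ iβ                        ≡⟨ -1^-cong-parity iβ (iα ℕ.+ iγ ℕ.* # A) parity-iβ ⟩
  -1ℤ ^ (iα ℕ.+ iγ ℕ.* # A)       ≡⟨ ^-distribˡ-+-* -1ℤ iα (iγ ℕ.* # A) ⟩
  sgn A α * -1ℤ ^ (iγ ℕ.* # A)    ≡⟨ cong (sgn A α *_) (^-*-assoc -1ℤ iγ (# A)) ⟨
  sgn A α * (sgn C γ ^ # A)       ∎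
  where
  open ≡-Reasoning
  module A = FinAbGroupTheory A
  module B = FinAbGroupTheory B
  module C = FinAbGroupTheory C
  iα = A.inversionCount α
  iβ = B.inversionCount β
  iγ = C.inversionCount γ
  parity-iβ : parity iβ ≡ parity (iα ℕ.+ iγ ℕ.* # A)
  parity-iβ = begin
    parity iβ
      ≡⟨ trans (B.parity-inversionCount β) parities ⟩
    A.permParity (Aut.perm α) ℙ.+ (parity (# A) ℙ.* C.permParity (Aut.perm γ))
      ≡⟨ cong₂ ℙ._+_ (A.parity-inversionCount α)
                     (trans (cong (ℙ._* parity (# A)) (C.parity-inversionCount γ)) (ℙ.*-comm (C.permParity (Aut.perm γ)) (parity (# A)))) ⟨
    parity iα ℙ.+ (parity iγ ℙ.* parity (# A))
      ≡⟨ trans (ℙ.+-homo-+ iα (iγ ℕ.* # A)) (cong (parity iα ℙ.+_) (ℙ.*-homo-* iγ (# A))) ⟨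
    parity (iα ℕ.+ iγ ℕ.* # A) ∎

proposition6p16 : (A B C : FinAbGroup) (f : Carrier A → Carrier B) (g : Carrier B → Carrier C)
    → ShortExact A B C f g
    → (β : Aut B) (α : Aut A)
    → (∀ a → ⟦ β ⟧ (f a) ≡ f (⟦ α ⟧ a))
    → (∃ λ (γ : Aut C) → ∀ b → ⟦ γ ⟧ (g b) ≡ g (⟦ β ⟧ b))
      × ((γ : Aut C) → (∀ b → ⟦ γ ⟧ (g b) ≡ g (⟦ β ⟧ b))
         → ¬ (2 ∣ (# C))
         → sgn B β ≡ sgn A α * (sgn C γ ^ (# A)))
proposition6p16 A B C f g ses β α β∘f = (inducedAut , inducedAut-g) , λ γ γ∘g #C-odd →
  sgn-from-permParity α β γ (Fibred.permParity-β β α β∘f γ γ∘g #C-odd)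
  where
  open ShortExactSequence ses
  open Induced β α β∘f
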